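{- Let $n\geq 2$ and let $H_n = G_2\cup G_3\cup\cdots\cup G_n$, where each $G_k$ is the weighted directed graph defined below for $\ell=1$ with blue edge weight $-n$, and the union identifies nodes with the same integer label (node set and edge set are the unions). Then the maximum weight of a directed path from node $0$ to node $2^n-1$ in $H_n$ is $0$.
   Context: The pruning function $\operatorname{P}_{1}:\mathbb{Z}_{>0}\to\mathbb{Z}_{\geq 0}$: write $m$ in binary, padded on the left with zeros as needed, let $z$ be the position (position $0$ = least significant bit) of the first zero bit counted from the right, let $q = 2^{z}\lfloor m/2^{z}\rfloor$, and set $\operatorname{P}_1(m)=\max(q-1,0)$. For integers $k\ge 2$ and $n$, $G_k$ is the weighted directed graph with node set $\{0\}\cup\{2^{k-1}-1,2^{k-1},\ldots,2^k-1\}$ and the following edges: for each $m$ with $2^{k-1}-1\le m<2^k-1$, a "blue" edge from $m$ to $m+1$ of weight $-n$, and a "red" edge from $\operatorname{P}_1(m)$ to $m$ of weight $+1$. The weight of a path is the sum of the weights of its edges. -}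

module Defs where

open import Data.Nat using (ℕ; zero; suc; _+_; _*_; _∸_; _^_; _≤_; _<_; _/_; _%_)
open import Data.Nat.Properties using (m^n≢0)
open import Data.Bool using (if_then_else_)
open import Data.Nat using (_≡ᵇ_)
open import Data.Integer as ℤ using (ℤ; +_; -_)

-- number of trailing one bits of m (= position z of the first zero bit,
-- counted from the right, position 0 = least significant bit).
-- The fuel argument (initialised to m) is always sufficient.
trailingOnesAux : ℕ → ℕ → ℕ
trailingOnesAux zero    m = zero
trailingOnesAux (suc f) m =
  if (m % 2) ≡ᵇ 1 then suc (trailingOnesAux f (m / 2)) else zero

firstZeroPos : ℕ → ℕ
firstZeroPos m = trailingOnesAux m m

P₁ : ℕ → ℕ
P₁ m = q ∸ 1
  where
  z = firstZeroPos m
  q = (2 ^ z) * _/_ m (2 ^ z) {{m^n≢0 2 z}}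

-- Edges of H_n = G_2 ∪ … ∪ G_n (blue edge weight -n), labelled by
-- source, target and weight.  A constructor records the G_k it comes from.
data Edge (n : ℕ) : ℕ → ℕ → ℤ → Set where
  blue : (k m : ℕ) → 2 ≤ k → k ≤ n →
         2 ^ (k ∸ 1) ∸ 1 ≤ m → m < 2 ^ k ∸ 1 →
         Edge n m (suc m) (- (+ n))
  red  : (k m : ℕ) → 2 ≤ k → k ≤ n →
         2 ^ (k ∸ 1) ∸ 1 ≤ m → m < 2 ^ k ∸ 1 →
         Edge n (P₁ m) m (+ 1)

-- Directed paths in H_n (the graph is acyclic: every edge strictly
-- increases the label, so walks and paths coincide).
data Path (n : ℕ) : ℕ → ℕ → Set where
  []  : ∀ {u} → Path n u u
  _∷_ : ∀ {u v w c} → Edge n u v c → Path n v w → Path n u w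

weight : ∀ {n u v} → Path n u v → ℤ
weight []                  = + 0
weight (_∷_ {c = c} e p)   = c ℤ.+ weight p

-- Write m + 1 = 2^z (2r + 1): then z is the number of trailing ones of m and
-- P₁ m = 2^z · 2r − 1.  So the potential φ x = popcount (x + 1), reset to 0 at
-- the endpoints 0 and 2^n − 1, grows by at least 1 along a red edge P₁ m → m
-- (φ m = popcount r + 1, φ (P₁ m) ≤ popcount r), and drops by at most n along a
-- blue edge, since labels below 2^n − 1 have successors of at most n bits.
-- Telescoping bounds the weight of a path from 0 to 2^n − 1 by φ (2^n − 1) − φ 0 = 0.
-- The bound is attained by the red edges 0 → 2^(n−1) − 1 → … → 2^n − 2^j − 1 → …
-- → 2^n − 2, each label having a single zero bit and being the pruning of the
-- next one, followed by the blue edge to 2^n − 1: n red edges and one blue edge.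
module Submission where

open import Defs
open import Data.Nat using (ℕ; zero; suc; _+_; _*_; _∸_; _^_; _≤_; _<_; _/_; _%_;
  z≤n; s≤s; s≤s⁻¹; NonZero; _≟_)
open import Data.Nat.Properties
open import Data.Nat.DivMod
open import Data.Nat.Divisibility using (n∣m*n)
open import Data.Integer as ℤ using (+_; -_; +≤+)
import Data.Integer.Properties as ℤ
open import Data.Product using (Σ; _×_; _,_; ∃-syntax)
open import Relation.Nullary using (yes; no)
open import Relation.Nullary.Negation using (contradiction)
open import Relation.Binary.PropositionalEquality
  using (_≡_; refl; sym; trans; cong; cong₂; subst; subst₂; module ≡-Reasoning)

[m*n+o]/n≡m : ∀ m {n o} .{{_ : NonZero n}} → o < n → (m * n + o) / n ≡ m
[m*n+o]/n≡m m {n} {o} o<n = begin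
  (m * n + o) / n    ≡⟨ +-distrib-/-∣ˡ o (n∣m*n m) ⟩
  m * n / n + o / n  ≡⟨ cong₂ _+_ (m*n/n≡m m n) (m<n⇒m/n≡0 o<n) ⟩
  m + 0              ≡⟨ +-identityʳ m ⟩
  m                  ∎
  where open ≡-Reasoning

[m*n+o]%n≡o : ∀ m {n o} .{{_ : NonZero n}} → o < n → (m * n + o) % n ≡ o
[m*n+o]%n≡o m {n} {o} o<n = begin
  (m * n + o) % n  ≡⟨ %-congˡ (+-comm (m * n) o) ⟩
  (o + m * n) % n  ≡⟨ [m+kn]%n≡m%n o m n ⟩
  o % n            ≡⟨ m<n⇒m%n≡m o<n ⟩
  o                ∎
  where open ≡-Reasoning

suc[m∸1]≡m : ∀ {m} → 0 < m → suc (m ∸ 1) ≡ m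
suc[m∸1]≡m {suc m} _ = refl

m*[1+n]∸1≡m*n+[m∸1] : ∀ m n → 0 < m → m * suc n ∸ 1 ≡ m * n + (m ∸ 1)
m*[1+n]∸1≡m*n+[m∸1] m n 0<m = begin
  m * suc n ∸ 1      ≡⟨ cong (_∸ 1) (trans (*-suc m n) (+-comm m (m * n))) ⟩
  m * n + m ∸ 1      ≡⟨ +-∸-assoc (m * n) 0<m ⟩
  m * n + (m ∸ 1)    ∎
  where open ≡-Reasoning

m≤1+n⇒m/2≤n : ∀ {m n} → m ≤ suc n → m / 2 ≤ n
m≤1+n⇒m/2≤n {zero}  _     = z≤n
m≤1+n⇒m/2≤n {suc m} m≤1+n = s≤s⁻¹ (<-≤-trans (m/n<m (suc m) 2 (s≤s (s≤s z≤n))) m≤1+n)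

2*[1+n]≡2+2*n : ∀ n → 2 * suc n ≡ suc (suc (2 * n))
2*[1+n]≡2+2*n n = cong suc (+-suc n (n + 0))

2*n%2≡0 : ∀ n → 2 * n % 2 ≡ 0
2*n%2≡0 n = trans (%-congˡ (*-comm 2 n)) (m*n%n≡0 n 2)

2*n/2≡n : ∀ n → 2 * n / 2 ≡ n
2*n/2≡n n = trans (/-congˡ (*-comm 2 n)) (m*n/n≡m n 2)

1+2*n≡n*2+1 : ∀ n → suc (2 * n) ≡ n * 2 + 1
1+2*n≡n*2+1 n = trans (cong suc (*-comm 2 n)) (+-comm 1 (n * 2))

[1+2*n]%2≡1 : ∀ n → suc (2 * n) % 2 ≡ 1
[1+2*n]%2≡1 n = trans (%-congˡ (1+2*n≡n*2+1 n)) ([m*n+o]%n≡o n (s≤s (s≤s z≤n)))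

[1+2*n]/2≡n : ∀ n → suc (2 * n) / 2 ≡ n
[1+2*n]/2≡n n = trans (/-congˡ (1+2*n≡n*2+1 n)) ([m*n+o]/n≡m n (s≤s (s≤s z≤n)))

data Parity : ℕ → Set where
  even : ∀ h → Parity (2 * h)
  odd  : ∀ h → Parity (suc (2 * h))

parity : ∀ m → Parity m
parity zero = even 0
parity (suc m) with parity m
... | even h = odd h
... | odd h  = subst Parity (2*[1+n]≡2+2*n h) (even (suc h))

trailingOnesAux-even : ∀ f h → trailingOnesAux (suc f) (2 * h) ≡ 0
trailingOnesAux-even f h rewrite 2*n%2≡0 h = refl

trailingOnesAux-odd : ∀ f h → trailingOnesAux (suc f) (suc (2 * h)) ≡ suc (trailingOnesAux f h)
trailingOnesAux-odd f h rewrite [1+2*n]%2≡1 h | [1+2*n]/2≡n h = refl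

trailingOnesAux-spec : ∀ f m → m ≤ f → ∃[ r ] suc m ≡ 2 ^ trailingOnesAux f m * suc (2 * r)
trailingOnesAux-spec zero    .0 z≤n = 0 , refl
trailingOnesAux-spec (suc f) m  m≤1+f with parity m
... | even h rewrite trailingOnesAux-even f h = h , sym (*-identityˡ (suc (2 * h)))
... | odd h rewrite trailingOnesAux-odd f h
  with trailingOnesAux-spec f h (≤-trans (m≤m+n h (h + 0)) (s≤s⁻¹ m≤1+f))
...   | r , 1+h≡ = r , (begin
  suc (suc (2 * h))          ≡⟨ sym (2*[1+n]≡2+2*n h) ⟩
  2 * suc h                  ≡⟨ cong (2 *_) 1+h≡ ⟩
  2 * (2 ^ t * suc (2 * r))  ≡⟨ sym (*-assoc 2 (2 ^ t) (suc (2 * r))) ⟩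
  2 * 2 ^ t * suc (2 * r)    ∎)
  where
  open ≡-Reasoning
  t : ℕ
  t = trailingOnesAux f h

trailingOnesAux-unique : ∀ f m j r → m ≤ f → suc m ≡ 2 ^ j * suc (2 * r) →
                         trailingOnesAux f m ≡ j
trailingOnesAux-unique f m j r m≤f eq with parity m | j | f
... | even h | zero    | zero   = refl
... | even h | zero    | suc f′ = trailingOnesAux-even f′ h
... | even h | suc j′  | _      =
  contradiction (trans (sym (*-assoc 2 (2 ^ j′) (suc (2 * r)))) (sym eq)) (even≢odd (2 ^ j′ * suc (2 * r)) h)
... | odd h  | zero    | _      =
  contradiction (trans (2*[1+n]≡2+2*n h) (trans eq (*-identityˡ _))) (even≢odd (suc h) r)
... | odd h  | suc j′  | suc f′ = begin
  trailingOnesAux (suc f′) (suc (2 * h))  ≡⟨ trailingOnesAux-odd f′ h ⟩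
  suc (trailingOnesAux f′ h)              ≡⟨ cong suc (trailingOnesAux-unique f′ h j′ r h≤f′ 1+h≡) ⟩
  suc j′                                  ∎
  where
  open ≡-Reasoning
  h≤f′ : h ≤ f′
  h≤f′ = ≤-trans (m≤m+n h (h + 0)) (s≤s⁻¹ m≤f)
  1+h≡ : suc h ≡ 2 ^ j′ * suc (2 * r)
  1+h≡ = *-cancelˡ-≡ (suc h) _ 2
    (trans (2*[1+n]≡2+2*n h) (trans eq (*-assoc 2 (2 ^ j′) (suc (2 * r)))))

firstZeroPos-spec : ∀ m → ∃[ r ] suc m ≡ 2 ^ firstZeroPos m * suc (2 * r)
firstZeroPos-spec m = trailingOnesAux-spec m m ≤-refl

P₁-odd-part : ∀ {m} z r → suc m ≡ 2 ^ z * suc (2 * r) → P₁ m ≡ 2 ^ z * (2 * r) ∸ 1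
P₁-odd-part {m} z r eq = begin
  P₁ m                     ≡⟨ cong (λ y → 2 ^ y * _/_ m (2 ^ y) {{m^n≢0 2 y}} ∸ 1) zero-pos ⟩
  2 ^ z * (m / 2 ^ z) ∸ 1  ≡⟨ cong (λ q → 2 ^ z * q ∸ 1) quotient ⟩
  2 ^ z * (2 * r) ∸ 1      ∎
  where
  open ≡-Reasoning
  instance
    2^z≢0 : NonZero (2 ^ z)
    2^z≢0 = m^n≢0 2 z
  zero-pos : firstZeroPos m ≡ z
  zero-pos = trailingOnesAux-unique m m z r ≤-refl eq
  m≡ : m ≡ 2 * r * 2 ^ z + (2 ^ z ∸ 1)
  m≡ = begin
    m                              ≡⟨ cong (_∸ 1) eq ⟩
    2 ^ z * suc (2 * r) ∸ 1        ≡⟨ m*[1+n]∸1≡m*n+[m∸1] (2 ^ z) (2 * r) (m^n>0 2 z) ⟩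
    2 ^ z * (2 * r) + (2 ^ z ∸ 1)  ≡⟨ cong (_+ (2 ^ z ∸ 1)) (*-comm (2 ^ z) (2 * r)) ⟩
    2 * r * 2 ^ z + (2 ^ z ∸ 1)    ∎
  quotient : m / 2 ^ z ≡ 2 * r
  quotient = trans (/-congˡ m≡) ([m*n+o]/n≡m (2 * r) (subst (2 ^ z ∸ 1 <_) (suc[m∸1]≡m (m^n>0 2 z)) (n<1+n _)))

popcountFuel : ℕ → ℕ → ℕ
popcountFuel zero    m = 0
popcountFuel (suc f) m = m % 2 + popcountFuel f (m / 2)

popcount : ℕ → ℕ
popcount m = popcountFuel m m

popcountFuel-zero : ∀ f → popcountFuel f 0 ≡ 0
popcountFuel-zero zero    = refl
popcountFuel-zero (suc f) = popcountFuel-zero f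

popcountFuel-irrelevant : ∀ f g m → m ≤ f → m ≤ g → popcountFuel f m ≡ popcountFuel g m
popcountFuel-irrelevant zero    zero    m  _   _   = refl
popcountFuel-irrelevant zero    (suc g) .0 z≤n _   = sym (popcountFuel-zero (suc g))
popcountFuel-irrelevant (suc f) zero    .0 _   z≤n = popcountFuel-zero (suc f)
popcountFuel-irrelevant (suc f) (suc g) m  m≤f m≤g = cong (_+_ (m % 2))
  (popcountFuel-irrelevant f g (m / 2) (m≤1+n⇒m/2≤n m≤f) (m≤1+n⇒m/2≤n m≤g))

popcount-unfold : ∀ m → popcount m ≡ m % 2 + popcount (m / 2)
popcount-unfold zero    = refl
popcount-unfold (suc m) = cong (_+_ (suc m % 2))
  (popcountFuel-irrelevant m (suc m / 2) (suc m / 2) (m≤1+n⇒m/2≤n ≤-refl) ≤-refl)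

popcount-even : ∀ h → popcount (2 * h) ≡ popcount h
popcount-even h = begin
  popcount (2 * h)                          ≡⟨ popcount-unfold (2 * h) ⟩
  2 * h % 2 + popcount (2 * h / 2)          ≡⟨ cong₂ _+_ (2*n%2≡0 h) (cong popcount (2*n/2≡n h)) ⟩
  popcount h                                ∎
  where open ≡-Reasoning

popcount-odd : ∀ h → popcount (suc (2 * h)) ≡ suc (popcount h)
popcount-odd h = begin
  popcount (suc (2 * h))                          ≡⟨ popcount-unfold (suc (2 * h)) ⟩
  suc (2 * h) % 2 + popcount (suc (2 * h) / 2)    ≡⟨ cong₂ _+_ ([1+2*n]%2≡1 h) (cong popcount ([1+2*n]/2≡n h)) ⟩
  suc (popcount h)                                ∎
  where open ≡-Reasoning

popcount-2^z* : ∀ z m → popcount (2 ^ z * m) ≡ popcount m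
popcount-2^z* zero    m = cong popcount (*-identityˡ m)
popcount-2^z* (suc z) m = begin
  popcount (2 * 2 ^ z * m)    ≡⟨ cong popcount (*-assoc 2 (2 ^ z) m) ⟩
  popcount (2 * (2 ^ z * m))  ≡⟨ popcount-even (2 ^ z * m) ⟩
  popcount (2 ^ z * m)        ≡⟨ popcount-2^z* z m ⟩
  popcount m                  ∎
  where open ≡-Reasoning

popcount-odd-part : ∀ {m} z r → m ≡ 2 ^ z * suc (2 * r) → popcount m ≡ suc (popcount r)
popcount-odd-part z r refl = trans (popcount-2^z* z (suc (2 * r))) (popcount-odd r)

popcount-< : ∀ n m → m < 2 ^ n → popcount m ≤ n
popcount-< zero    .0 (s≤s z≤n) = z≤n
popcount-< (suc n) m  m<2^[1+n] = begin
  popcount m                ≡⟨ popcount-unfold m ⟩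
  m % 2 + popcount (m / 2)  ≤⟨ +-mono-≤ (s≤s⁻¹ (m%n<n m 2)) (popcount-< n (m / 2) m/2<2^n) ⟩
  1 + n                     ∎
  where
  open ≤-Reasoning
  m/2<2^n : m / 2 < 2 ^ n
  m/2<2^n = m<n*o⇒m/o<n (subst (m <_) (*-comm 2 (2 ^ n)) m<2^[1+n])

potential : ℕ → ℕ → ℕ
potential n m with m ≟ 0 | m ≟ 2 ^ n ∸ 1
... | no _ | no _ = popcount (suc m)
... | _    | _    = 0

potential-≤ : ∀ n m → potential n m ≤ popcount (suc m)
potential-≤ n m with m ≟ 0 | m ≟ 2 ^ n ∸ 1
... | no _  | no _  = ≤-refl
... | yes _ | _     = z≤n
... | no _  | yes _ = z≤n

potential-0 : ∀ n → potential n 0 ≡ 0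
potential-0 n with 0 ≟ 2 ^ n ∸ 1
... | yes _ = refl
... | no _  = refl

potential-top : ∀ n → potential n (2 ^ n ∸ 1) ≡ 0
potential-top n with 2 ^ n ∸ 1 ≟ 0 | 2 ^ n ∸ 1 ≟ 2 ^ n ∸ 1
... | yes _ | _     = refl
... | no _  | yes _ = refl
... | no _  | no ≢  = contradiction refl ≢

potential-inner : ∀ n m → 1 ≤ m → m < 2 ^ n ∸ 1 → potential n m ≡ popcount (suc m)
potential-inner n m 1≤m m<top with m ≟ 0 | m ≟ 2 ^ n ∸ 1
... | no _     | no _    = refl
... | yes refl | _       = contradiction 1≤m λ ()
... | no _     | yes ≡top = contradiction ≡top (<⇒≢ m<top)

potential-P₁-≤ : ∀ n z r → potential n (2 ^ z * (2 * r) ∸ 1) ≤ popcount r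
potential-P₁-≤ n z zero = subst (λ x → potential n (x ∸ 1) ≤ 0) (sym (*-zeroʳ (2 ^ z)))
  (≤-reflexive (potential-0 n))
potential-P₁-≤ n z (suc r) = begin
  potential n (x ∸ 1)       ≤⟨ potential-≤ n (x ∸ 1) ⟩
  popcount (suc (x ∸ 1))    ≡⟨ cong popcount (suc[m∸1]≡m 0<x) ⟩
  popcount x                ≡⟨ popcount-2^z* z (2 * suc r) ⟩
  popcount (2 * suc r)      ≡⟨ popcount-even (suc r) ⟩
  popcount (suc r)          ∎
  where
  open ≤-Reasoning
  x : ℕ
  x = 2 ^ z * (2 * suc r)
  0<x : 0 < x
  0<x = ≤-trans (m^n>0 2 z) (m≤m*n (2 ^ z) (2 * suc r))

level-inner : ∀ {n k m} → 2 ≤ k → k ≤ n → 2 ^ (k ∸ 1) ∸ 1 ≤ m → m < 2 ^ k ∸ 1 →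
              1 ≤ m × m < 2 ^ n ∸ 1
level-inner {k = suc zero} (s≤s ()) _ _ _
level-inner {k = suc (suc k)} _ k≤n lo hi =
  ≤-trans (∸-monoˡ-≤ 1 (*-monoʳ-≤ 2 (m^n>0 2 k))) lo ,
  <-≤-trans hi (∸-monoˡ-≤ 1 (^-monoʳ-≤ 2 k≤n))

edge-potential : ∀ {n u v c} → Edge n u v c → c ℤ.+ + potential n u ℤ.≤ + potential n v
edge-potential {n} (blue k m 2≤k k≤n lo hi) with level-inner 2≤k k≤n lo hi
... | _ , m<top = begin
  - + n ℤ.+ + potential n m  ≤⟨ ℤ.+-monoʳ-≤ (- + n) (+≤+ potential≤n) ⟩
  - + n ℤ.+ + n              ≡⟨ ℤ.+-inverseˡ (+ n) ⟩
  + 0                        ≤⟨ +≤+ z≤n ⟩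
  + potential n (suc m)      ∎
  where
  open ℤ.≤-Reasoning
  potential≤n : potential n m ≤ n
  potential≤n = ≤-trans (potential-≤ n m)
    (popcount-< n (suc m) (subst (suc m <_) (suc[m∸1]≡m (m^n>0 2 n)) (s≤s m<top)))
edge-potential {n} (red k m 2≤k k≤n lo hi)
  with firstZeroPos-spec m | level-inner 2≤k k≤n lo hi
... | r , 1+m≡ | 1≤m , m<top = +≤+ (begin
  suc (potential n (P₁ m))                      ≡⟨ cong (λ x → suc (potential n x)) (P₁-odd-part z r 1+m≡) ⟩
  suc (potential n (2 ^ z * (2 * r) ∸ 1))       ≤⟨ s≤s (potential-P₁-≤ n z r) ⟩
  suc (popcount r)                              ≡⟨ sym (popcount-odd-part z r 1+m≡) ⟩
  popcount (suc m)                              ≡⟨ sym (potential-inner n m 1≤m m<top) ⟩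
  potential n m                                 ∎)
  where
  open ≤-Reasoning
  z : ℕ
  z = firstZeroPos m

path-potential : ∀ {n u v} (p : Path n u v) → weight p ℤ.+ + potential n u ℤ.≤ + potential n v
path-potential []                          = ℤ.≤-refl
path-potential {n} {u} {w} (_∷_ {v = v} {c = c} e p) = begin
  (c ℤ.+ weight p) ℤ.+ + potential n u    ≡⟨ cong (ℤ._+ + potential n u) (ℤ.+-comm c (weight p)) ⟩
  (weight p ℤ.+ c) ℤ.+ + potential n u    ≡⟨ ℤ.+-assoc (weight p) c (+ potential n u) ⟩
  weight p ℤ.+ (c ℤ.+ + potential n u)    ≤⟨ ℤ.+-monoʳ-≤ (weight p) (edge-potential e) ⟩
  weight p ℤ.+ + potential n v            ≤⟨ path-potential p ⟩
  + potential n w                         ∎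
  where open ℤ.≤-Reasoning

weight-≤-0 : ∀ n (p : Path n 0 (2 ^ n ∸ 1)) → weight p ℤ.≤ + 0
weight-≤-0 n p = subst₂ ℤ._≤_ (trans (cong (λ x → weight p ℤ.+ + x) (potential-0 n)) (ℤ.+-identityʳ (weight p)))
  (cong +_ (potential-top n)) (path-potential p)

mersenne : ℕ → ℕ
mersenne zero    = 0
mersenne (suc d) = suc (2 * mersenne d)

suc-mersenne : ∀ d → suc (mersenne d) ≡ 2 ^ d
suc-mersenne zero    = refl
suc-mersenne (suc d) = trans (sym (2*[1+n]≡2+2*n (mersenne d))) (cong (2 *_) (suc-mersenne d))

-- 2^(j+d+1) − 2^j − 1: in binary, d ones, a zero at position j, then j ones.
gap : ℕ → ℕ → ℕ
gap j d = 2 ^ j * suc (2 * mersenne d) ∸ 1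

suc-gap : ∀ j d → suc (gap j d) ≡ 2 ^ j * suc (2 * mersenne d)
suc-gap j d = suc[m∸1]≡m (≤-trans (m^n>0 2 j) (m≤m*n (2 ^ j) (suc (2 * mersenne d))))

suc-gap+2^j : ∀ j d → suc (gap j d) + 2 ^ j ≡ 2 ^ suc (j + d)
suc-gap+2^j j d = begin
  suc (gap j d) + 2 ^ j                        ≡⟨ cong (_+ 2 ^ j) (suc-gap j d) ⟩
  2 ^ j * suc (2 * mersenne d) + 2 ^ j         ≡⟨ +-comm (2 ^ j * suc (2 * mersenne d)) (2 ^ j) ⟩
  2 ^ j + 2 ^ j * suc (2 * mersenne d)         ≡⟨ sym (*-suc (2 ^ j) (suc (2 * mersenne d))) ⟩
  2 ^ j * suc (suc (2 * mersenne d))           ≡⟨ cong (2 ^ j *_) (sym (2*[1+n]≡2+2*n (mersenne d))) ⟩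
  2 ^ j * (2 * suc (mersenne d))               ≡⟨ cong (λ x → 2 ^ j * (2 * x)) (suc-mersenne d) ⟩
  2 ^ j * 2 ^ suc d                            ≡⟨ sym (^-distribˡ-+-* 2 j (suc d)) ⟩
  2 ^ (j + suc d)                              ≡⟨ cong (2 ^_) (+-suc j d) ⟩
  2 ^ suc (j + d)                              ∎
  where open ≡-Reasoning

gap-level : ∀ {N j d} → j + d ≡ N → 2 ^ N ∸ 1 ≤ gap j d × gap j d < 2 ^ suc N ∸ 1
gap-level {N} {j} {d} refl =
  ∸-monoˡ-≤ 1 (+-cancelʳ-≤ (2 ^ j) (2 ^ N) (suc (gap j d))
    (subst (2 ^ N + 2 ^ j ≤_) (sym (suc-gap+2^j j d)) (+-monoʳ-≤ (2 ^ N) 2^j≤2^N))) ,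
  m+n≤o⇒m≤o∸n (suc (gap j d))
    (subst (suc (gap j d) + 1 ≤_) (suc-gap+2^j j d) (+-monoʳ-≤ (suc (gap j d)) (m^n>0 2 j)))
  where
  2^j≤2^N : 2 ^ j ≤ 2 ^ N + 0
  2^j≤2^N = ≤-trans (^-monoʳ-≤ 2 (m≤m+n j d)) (m≤m+n (2 ^ N) 0)

suc-gap-0 : ∀ d → suc (gap 0 d) ≡ 2 ^ suc d ∸ 1
suc-gap-0 d = trans (sym (m+n∸n≡m (suc (gap 0 d)) 1)) (cong (_∸ 1) (suc-gap+2^j 0 d))

P₁-gap-0 : ∀ j → P₁ (gap j 0) ≡ 0
P₁-gap-0 j = trans (P₁-odd-part j 0 (suc-gap j 0)) (cong (_∸ 1) (*-zeroʳ (2 ^ j)))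

P₁-gap-suc : ∀ j d → P₁ (gap j (suc d)) ≡ gap (suc j) d
P₁-gap-suc j d = trans (P₁-odd-part j (mersenne (suc d)) (suc-gap j (suc d))) (cong (_∸ 1) (begin
  2 ^ j * (2 * x)  ≡⟨ sym (*-assoc (2 ^ j) 2 x) ⟩
  2 ^ j * 2 * x    ≡⟨ cong (_* x) (*-comm (2 ^ j) 2) ⟩
  2 * 2 ^ j * x    ∎))
  where
  open ≡-Reasoning
  x : ℕ
  x = suc (2 * mersenne d)

ladder : ∀ N j d → j + d ≡ N → 1 ≤ N →
         Σ (Path (suc N) (gap j d) (2 ^ suc N ∸ 1)) (λ p → weight p ≡ + j ℤ.- + suc N)
ladder N zero .N refl 1≤N with gap-level {N} {0} {N} refl
... | lo , hi = to-top ∷ [] , refl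
  where
  to-top : Edge (suc N) (gap 0 N) (2 ^ suc N ∸ 1) (- + suc N)
  to-top = subst (λ t → Edge (suc N) (gap 0 N) t (- + suc N)) (suc-gap-0 N)
    (blue (suc N) (gap 0 N) (s≤s 1≤N) ≤-refl lo hi)
ladder N (suc j) d j+d≡N 1≤N
  with ladder N j (suc d) (trans (+-suc j d) j+d≡N) 1≤N | gap-level {N} {j} {suc d} (trans (+-suc j d) j+d≡N)
... | p , weight≡ | lo , hi = climb ∷ p , (begin
  + 1 ℤ.+ weight p                      ≡⟨ cong (ℤ._+_ (+ 1)) weight≡ ⟩
  + 1 ℤ.+ (+ j ℤ.- + suc N)             ≡⟨ sym (ℤ.+-assoc (+ 1) (+ j) (- + suc N)) ⟩
  + suc j ℤ.- + suc N                   ∎)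
  where
  open ≡-Reasoning
  climb : Edge (suc N) (gap (suc j) d) (gap j (suc d)) (+ 1)
  climb = subst (λ s → Edge (suc N) s (gap j (suc d)) (+ 1)) (P₁-gap-suc j d)
    (red (suc N) (gap j (suc d)) (s≤s 1≤N) ≤-refl lo hi)

optimal-path : ∀ N → 1 ≤ N → Σ (Path (suc N) 0 (2 ^ suc N ∸ 1)) (λ p → weight p ≡ + 0)
optimal-path N 1≤N with ladder N N 0 (+-identityʳ N) 1≤N | gap-level {N} {N} {0} (+-identityʳ N)
... | p , weight≡ | lo , hi = start ∷ p , (begin
  + 1 ℤ.+ weight p                 ≡⟨ cong (ℤ._+_ (+ 1)) weight≡ ⟩
  + 1 ℤ.+ (+ N ℤ.- + suc N)        ≡⟨ sym (ℤ.+-assoc (+ 1) (+ N) (- + suc N)) ⟩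
  + suc N ℤ.- + suc N              ≡⟨ ℤ.+-inverseʳ (+ suc N) ⟩
  + 0                              ∎)
  where
  open ≡-Reasoning
  start : Edge (suc N) 0 (gap N 0) (+ 1)
  start = subst (λ s → Edge (suc N) s (gap N 0) (+ 1)) (P₁-gap-0 N)
    (red (suc N) (gap N 0) (s≤s 1≤N) ≤-refl lo hi)

mainTheorem5 : (n : ℕ) → 2 ≤ n →
    Σ (Path n 0 (2 ^ n ∸ 1)) (λ p → weight p ≡ + 0)
      × ((p : Path n 0 (2 ^ n ∸ 1)) → weight p ℤ.≤ + 0)
mainTheorem5 (suc N) (s≤s 1≤N) = optimal-path N 1≤N , weight-≤-0 (suc N)
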